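{- Let $k\ge 1$ and $n\ge k+3$ be integers. (1) The 3-graph $S_3(n,k)$ contains no linear path of length $2k+1$, and $\delta_1(S_3(n,k))=kn-\frac{k^2}{2}-\frac{3k}{2}$. (2) The 3-graph $S_3^+(n,k)$ contains no linear path of length $2k+2$, and $\delta_1(S_3^+(n,k))=kn-\frac{k^2}{2}-\frac{3k}{2}+1$.
   Context: A 3-graph is a simple 3-uniform hypergraph. $d_H(v)$ is the number of edges containing $v$ and $\delta_1(H)=\min_v d_H(v)$. A linear path of length $k$ is a collection of $k$ edges $e_1,\dots,e_k$ with $|e_i\cap e_j|=1$ if $|i-j|=1$ and $e_i\cap e_j=\emptyset$ otherwise. $S_3(n,k)$ is the 3-graph on vertex set $A\cup B$ with $|A|=k$, $|B|=n-k$, $A\cap B=\emptyset$, whose edges are all 3-subsets $e$ of $A\cup B$ with $e\cap A\neq\emptyset$. For a set $T$ and $s\le |T|$, $C_3(|T|,s)$ on $T$ denotes the 3-graph on $T$ with a fixed $s$-set $S\subseteq T$ whose edges are all 3-subsets of $T$ containing $S$. $S_3^+(n,k)$ is obtained from $S_3(n,k)$ by adding the edges of a copy of $C_3(n-k,2)$ on vertex set $B$ (i.e., fix two vertices $u,w\in B$ and add all triples $\{u,w,x\}$ with $x\in B\setminus\{u,w\}$). -}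

module Defs where

open import Data.Nat using (ℕ; zero; suc; _+_; _*_; _<_; _≤_)
open import Data.Nat.Properties using (_≟_; _<?_; _≤?_)
open import Data.Bool using (Bool; true; false)
open import Data.Fin using (Fin; toℕ)
import Data.Fin as Fin
open import Data.Fin.Subset using (Subset; _∈_; _∩_; ∣_∣; inside; outside)
open import Data.Fin.Subset.Properties using (_∈?_)
open import Data.Vec using (_∷_; [])
open import Data.List using (List; []; _∷_; map; _++_; filter; length)
open import Data.Product using (Σ; ∃; _×_; _,_; proj₁)
open import Data.Sum using (_⊎_; inj₁; inj₂)
open import Data.Empty using (⊥-elim)
open import Relation.Nullary using (Dec; yes; no)
open import Relation.Nullary.Decidable using (_×-dec_; _⊎-dec_)
open import Relation.Unary using (Decidable)
open import Relation.Binary.PropositionalEquality using (_≡_)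

record Graph3 (n : ℕ) : Set₁ where
  field
    Edge    : Subset n → Set
    Edge?   : Decidable Edge
    uniform : ∀ s → Edge s → ∣ s ∣ ≡ 3
open Graph3 public

allSubsets : (n : ℕ) → List (Subset n)
allSubsets zero    = [] ∷ []
allSubsets (suc n) = map (outside ∷_) (allSubsets n) ++ map (inside ∷_) (allSubsets n)

degree : ∀ {n} → Graph3 n → Fin n → ℕ
degree {n} H v = length (filter (λ s → Edge? H s ×-dec (v ∈? s)) (allSubsets n))

MinDegreeIs : ∀ {n} → Graph3 n → ℕ → Set
MinDegreeIs H d = (∀ v → d ≤ degree H v) × (∃ λ v → degree H v ≡ d)

HasLinearPath : ∀ {n} → Graph3 n → ℕ → Set
HasLinearPath {n} H L =
  Σ (Fin L → Subset n) λ e →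
    (∀ i → Edge H (e i)) ×
    (∀ i j → suc (toℕ i) ≡ toℕ j → ∣ e i ∩ e j ∣ ≡ 1) ×
    (∀ i j → suc (toℕ i) < toℕ j → ∣ e i ∩ e j ∣ ≡ 0)

-- S_3(n,k): A = {v : toℕ v < k}, B = the rest; edges = 3-sets meeting A
S3Edge : ∀ n (k : ℕ) → Subset n → Set
S3Edge n k s = (∣ s ∣ ≡ 3) × (∃ λ (v : Fin n) → (v ∈ s) × (toℕ v < k))

-- S_3^+(n,k): additionally all triples {u, w, x}, x ∈ B, where u, w ∈ B are the
-- vertices with toℕ u = k and toℕ w = k + 1.
S3PlusEdge : ∀ n (k : ℕ) → Subset n → Set
S3PlusEdge n k s =
  S3Edge n k s ⊎
  ((∣ s ∣ ≡ 3) × (∀ (v : Fin n) → v ∈ s → k ≤ toℕ v) ×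
    (∃ λ (u : Fin n) → (u ∈ s) × (toℕ u ≡ k)) ×
    (∃ λ (w : Fin n) → (w ∈ s) × (toℕ w ≡ suc k)))

private
  anyFin? : ∀ {n} {P : Fin n → Set} → Decidable P → Dec (∃ P)
  anyFin? {zero} P? = no λ { (() , _) }
  anyFin? {suc n} {P} P? with P? Fin.zero | anyFin? {n} (λ i → P? (Fin.suc i))
  ... | yes p | _ = yes (Fin.zero , p)
  ... | no _  | yes (i , q) = yes (Fin.suc i , q)
  ... | no ¬p | no ¬q = no λ { (Fin.zero , p) → ¬p p ; (Fin.suc i , q) → ¬q (i , q) }

  allFin? : ∀ {n} {P : Fin n → Set} → Decidable P → Dec (∀ i → P i)
  allFin? {zero} P? = yes λ ()
  allFin? {suc n} {P} P? with P? Fin.zero | allFin? {n} (λ i → P? (Fin.suc i))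
  ... | yes p | yes q = yes λ { Fin.zero → p ; (Fin.suc i) → q i }
  ... | no ¬p | _ = no λ f → ¬p (f Fin.zero)
  ... | yes _ | no ¬q = no λ f → ¬q (λ i → f (Fin.suc i))

  imp? : ∀ {A B : Set} → Dec A → Dec B → Dec (A → B)
  imp? _ (yes b) = yes λ _ → b
  imp? (no ¬a) _ = yes λ a → ⊥-elim (¬a a)
  imp? (yes a) (no ¬b) = no λ f → ¬b (f a)

S3Edge? : ∀ n k → Decidable (S3Edge n k)
S3Edge? n k s = (∣ s ∣ ≟ 3) ×-dec anyFin? (λ v → (v ∈? s) ×-dec (toℕ v <? k))

S3PlusEdge? : ∀ n k → Decidable (S3PlusEdge n k)
S3PlusEdge? n k s =
  S3Edge? n k s ⊎-dec
  ((∣ s ∣ ≟ 3) ×-dec allFin? (λ v → imp? (v ∈? s) (k ≤? toℕ v)) ×-dec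
    anyFin? (λ u → (u ∈? s) ×-dec (toℕ u ≟ k)) ×-dec
    anyFin? (λ w → (w ∈? s) ×-dec (toℕ w ≟ suc k)))

S3 : (n k : ℕ) → Graph3 n
S3 n k = record { Edge = S3Edge n k ; Edge? = S3Edge? n k ; uniform = λ s e → proj₁ e }

S3⁺ : (n k : ℕ) → Graph3 n
S3⁺ n k = record
  { Edge = S3PlusEdge n k ; Edge? = S3PlusEdge? n k
  ; uniform = λ { s (inj₁ e) → proj₁ e ; s (inj₂ e) → proj₁ e } }

-- Any k + 1 pairwise disjoint edges of S₃(n,k) would meet the k-set A in k + 1 distinct vertices,
-- and the edges of even index in a linear path of length 2k + 1 form such a family. In S₃⁺(n,k)
-- every edge missing A contains both hubs u, w, so a linear path uses at most one such edge;
-- hence its even-indexed or its odd-indexed edges, k + 1 pairwise disjoint ones when the length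
-- is 2k + 2, all meet A.
-- Of the C(n-1,2) triples through a vertex of B, exactly C(n-k-1,2) avoid A, so the vertices of B
-- have the minimum degree C(n-1,2) - C(n-k-1,2) of S₃(n,k). In S₃⁺(n,k) a vertex of B \ {u, w}
-- gains exactly one edge, and u and w gain at least as many. All these counts are instances of
-- one formula: the t-subsets of Fin n containing c prescribed vertices, avoiding some others and
-- unconstrained on the remaining f vertices number C(f, t - c).

module Submission where

open import Defs
open import Data.Nat using (ℕ; zero; suc; _+_; _*_; _≤_; _<_; _<ᵇ_; _≡ᵇ_; z≤n; s≤s)
open import Data.Nat.Properties
open import Data.Nat.Combinatorics using (_C_; nC1≡n; nCk+nC[k+1]≡[n+1]C[k+1])
open import Data.Nat.Tactic.RingSolver using (solve-∀)
open import Data.Bool using (Bool; true; false; if_then_else_)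
open import Data.Fin as Fin using (Fin; toℕ; fromℕ<)
import Data.Fin.Properties as Finₚ
open import Data.Fin.Subset using (Subset; _∈_; _∩_; ∣_∣; inside; outside)
open import Data.Fin.Subset.Properties using (_∈?_; x∈p∩q⁺; x∈p⇒∣p-x∣<∣p∣; x∈p∧x≢y⇒x∈p-y)
open import Data.Vec using ([]; _∷_; here; there)
open import Data.List using ([]; _∷_; filter; length; map; _++_)
import Data.List.Properties as Listₚ
open import Data.List.Relation.Unary.All using (universal)
open import Data.Product using (∃; ∃₂; _×_; _,_; proj₁; proj₂)
open import Data.Sum using (_⊎_; inj₁; inj₂)
open import Data.Empty using (⊥; ⊥-elim)
open import Data.Unit using (⊤; tt)
open import Function using (_∘_; _⇔_; mk⇔; Equivalence)
open import Relation.Nullary using (¬_; Dec; yes; no)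
open import Relation.Binary.Definitions using (tri<; tri≈; tri>)
open import Relation.Nullary.Decidable using (_×-dec_; ¬?)
open import Level using (0ℓ)
open import Relation.Unary using (Pred; Decidable)
open import Relation.Binary.PropositionalEquality
  using (_≡_; _≢_; refl; sym; trans; cong; cong₂; subst; subst₂; module ≡-Reasoning)

module _ {A : Set} {P Q : Pred A 0ℓ} (P? : Decidable P) (Q? : Decidable Q) where

  length-filter-mono : (∀ {x} → P x → Q x) → ∀ xs → length (filter P? xs) ≤ length (filter Q? xs)
  length-filter-mono P⇒Q [] = z≤n
  length-filter-mono P⇒Q (x ∷ xs) with P? x | Q? x
  ... | yes p | yes _ = s≤s (length-filter-mono P⇒Q xs)
  ... | yes p | no ¬q = ⊥-elim (¬q (P⇒Q p))
  ... | no _  | yes _ = m≤n⇒m≤1+n (length-filter-mono P⇒Q xs)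
  ... | no _  | no _  = length-filter-mono P⇒Q xs

  length-filter-split : ∀ xs → length (filter P? xs) ≡
    length (filter (λ x → P? x ×-dec Q? x) xs) + length (filter (λ x → P? x ×-dec ¬? (Q? x)) xs)
  length-filter-split [] = refl
  length-filter-split (x ∷ xs) with P? x | Q? x
  ... | yes _ | yes _ = cong suc (length-filter-split xs)
  ... | yes _ | no _  = trans (cong suc (length-filter-split xs)) (sym (+-suc _ _))
  ... | no _  | _     = length-filter-split xs

length-filter-map : ∀ {A B : Set} {P : Pred B 0ℓ} (P? : Decidable P) (f : A → B) xs →
  length (filter P? (map f xs)) ≡ length (filter (P? ∘ f) xs)
length-filter-map P? f [] = refl
length-filter-map P? f (x ∷ xs) with P? (f x)
... | yes _ = cong suc (length-filter-map P? f xs)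
... | no _  = length-filter-map P? f xs

countSubsets : ∀ n {P : Pred (Subset n) 0ℓ} → Decidable P → ℕ
countSubsets n P? = length (filter P? (allSubsets n))

countSubsets-suc : ∀ n {P : Pred (Subset (suc n)) 0ℓ} (P? : Decidable P) →
  countSubsets (suc n) P? ≡ countSubsets n (P? ∘ (outside ∷_)) + countSubsets n (P? ∘ (inside ∷_))
countSubsets-suc n P? = begin
  length (filter P? (map (outside ∷_) (allSubsets n) ++ map (inside ∷_) (allSubsets n)))
    ≡⟨ cong length (Listₚ.filter-++ P? (map (outside ∷_) (allSubsets n)) _) ⟩
  length (filter P? (map (outside ∷_) (allSubsets n)) ++ filter P? (map (inside ∷_) (allSubsets n)))
    ≡⟨ Listₚ.length-++ (filter P? (map (outside ∷_) (allSubsets n))) ⟩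
  _ ≡⟨ cong₂ _+_ (length-filter-map P? _ (allSubsets n)) (length-filter-map P? _ (allSubsets n)) ⟩
  countSubsets n (P? ∘ (outside ∷_)) + countSubsets n (P? ∘ (inside ∷_)) ∎
  where open ≡-Reasoning

countSubsets-cong : ∀ n {P Q : Pred (Subset n) 0ℓ} (P? : Decidable P) (Q? : Decidable Q) →
  (∀ {s} → P s → Q s) → (∀ {s} → Q s → P s) → countSubsets n P? ≡ countSubsets n Q?
countSubsets-cong n P? Q? P⇒Q Q⇒P = cong length (Listₚ.filter-≐ P? Q? (P⇒Q , Q⇒P) (allSubsets n))

countSubsets-none : ∀ n {P : Pred (Subset n) 0ℓ} (P? : Decidable P) → (∀ s → ¬ P s) → countSubsets n P? ≡ 0
countSubsets-none n P? ¬P = cong length (Listₚ.filter-none P? (universal ¬P (allSubsets n)))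

data Label : Set where
  forced excluded free : Label

Pattern : Set
Pattern = ℕ → Label

_◂_ : Label → Pattern → Pattern
(l ◂ L) zero    = l
(l ◂ L) (suc j) = L j

Fits : Label → Bool → Set
Fits forced   b = b ≡ true
Fits excluded b = b ≡ false
Fits free     b = ⊤

fits? : ∀ l b → Dec (Fits l b)
fits? forced   true  = yes refl
fits? forced   false = no λ ()
fits? excluded true  = no λ ()
fits? excluded false = yes refl
fits? free     b     = yes tt

Respects : ∀ {n} → Pattern → Subset n → Set
Respects L []      = ⊤
Respects L (b ∷ s) = Fits (L 0) b × Respects (L ∘ suc) s

respects? : ∀ {n} L → Decidable (Respects {n} L)
respects? L []      = yes tt
respects? L (b ∷ s) = fits? (L 0) b ×-dec respects? (L ∘ suc) s

SizedRespecting : ∀ {n} → Pattern → ℕ → Subset n → Set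
SizedRespecting L t s = ∣ s ∣ ≡ t × Respects L s

sizedRespecting? : ∀ {n} L t → Decidable (SizedRespecting {n} L t)
sizedRespecting? L t s = (∣ s ∣ ≟ t) ×-dec respects? L s

indicator : Label → Label → ℕ
indicator forced   forced   = 1
indicator excluded excluded = 1
indicator free     free     = 1
indicator _        _        = 0

occurrences : Label → ℕ → Pattern → ℕ
occurrences l zero    L = 0
occurrences l (suc n) L = indicator (L 0) l + occurrences l n (L ∘ suc)

-- The number of t-subsets of an (f + c)-set containing a fixed c-subset: C(f, t - c), or 0 if t < c.
supersets : ℕ → ℕ → ℕ → ℕ
supersets f zero    t       = f C t
supersets f (suc c) zero    = 0
supersets f (suc c) (suc t) = supersets f c t

supersets-pascal₀ : ∀ f c → supersets (suc f) c 0 ≡ supersets f c 0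
supersets-pascal₀ f zero    = refl
supersets-pascal₀ f (suc c) = refl

supersets-pascal : ∀ f c t → supersets (suc f) c (suc t) ≡ supersets f c (suc t) + supersets f c t
supersets-pascal f zero    t       = trans (sym (nCk+nC[k+1]≡[n+1]C[k+1] f t)) (+-comm (f C t) (f C suc t))
supersets-pascal f (suc c) zero    = trans (supersets-pascal₀ f c) (sym (+-identityʳ _))
supersets-pascal f (suc c) (suc t) = supersets-pascal f c t

countSubsets-sizedRespecting : ∀ n L t →
  countSubsets n (sizedRespecting? L t) ≡ supersets (occurrences free n L) (occurrences forced n L) t
countSubsets-sizedRespecting zero    L zero    = refl
countSubsets-sizedRespecting zero    L (suc t) = refl
countSubsets-sizedRespecting (suc n) L t =
  trans (countSubsets-suc n (sizedRespecting? L t))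
        (byHead (L 0) (L ∘ suc) (countSubsets-sizedRespecting n (L ∘ suc)) t)
  where
  outside-fits : ∀ l L′ t → Fits l false →
    countSubsets n (sizedRespecting? (l ◂ L′) t ∘ (outside ∷_)) ≡ countSubsets n (sizedRespecting? L′ t)
  outside-fits l L′ t fits = countSubsets-cong n _ (sizedRespecting? L′ t)
    (λ (size , _ , resp) → size , resp) (λ (size , resp) → size , fits , resp)

  inside-fits : ∀ l L′ t → Fits l true →
    countSubsets n (sizedRespecting? (l ◂ L′) (suc t) ∘ (inside ∷_)) ≡ countSubsets n (sizedRespecting? L′ t)
  inside-fits l L′ t fits = countSubsets-cong n _ (sizedRespecting? L′ t)
    (λ (size , _ , resp) → suc-injective size , resp) (λ (size , resp) → cong suc size , fits , resp)

  -- On subsets b ∷ s the pattern L is definitionally L 0 ◂ (L ∘ suc), so the step may split on the head label.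
  byHead : ∀ l L′ → (∀ t → countSubsets n (sizedRespecting? L′ t) ≡
                            supersets (occurrences free n L′) (occurrences forced n L′) t) → ∀ t →
    countSubsets n (sizedRespecting? (l ◂ L′) t ∘ (outside ∷_)) +
    countSubsets n (sizedRespecting? (l ◂ L′) t ∘ (inside ∷_))
      ≡ supersets (indicator l free + occurrences free n L′) (indicator l forced + occurrences forced n L′) t
  byHead forced L′ ih zero =
    cong₂ _+_ (countSubsets-none n _ λ { _ (_ , () , _) }) (countSubsets-none n _ λ { _ () })
  byHead forced L′ ih (suc t) =
    cong₂ _+_ (countSubsets-none n _ λ { _ (_ , () , _) }) (trans (inside-fits forced L′ t refl) (ih t))
  byHead excluded L′ ih t =
    trans (cong₂ _+_ (trans (outside-fits excluded L′ t refl) (ih t)) (countSubsets-none n _ λ { _ (_ , () , _) }))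
          (+-identityʳ _)
  byHead free L′ ih zero =
    trans (cong₂ _+_ (trans (outside-fits free L′ 0 tt) (ih 0)) (countSubsets-none n _ λ { _ () }))
          (trans (+-identityʳ _) (sym (supersets-pascal₀ (occurrences free n L′) (occurrences forced n L′))))
  byHead free L′ ih (suc t) =
    trans (cong₂ _+_ (trans (outside-fits free L′ (suc t) tt) (ih (suc t))) (trans (inside-fits free L′ t tt) (ih t)))
          (sym (supersets-pascal (occurrences free n L′) (occurrences forced n L′) t))

below : ℕ → Pattern
below k j = if j <ᵇ k then excluded else free

force : ℕ → Pattern → Pattern
force v L j = if j ≡ᵇ v then forced else L j

below-free : ∀ {k j} → k ≤ j → below k j ≡ free
below-free z≤n     = refl
below-free (s≤s p) = below-free p

force-other : ∀ {j v} L → j ≢ v → force v L j ≡ L j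
force-other {zero}  {zero}  L j≢v = ⊥-elim (j≢v refl)
force-other {zero}  {suc v} L j≢v = refl
force-other {suc j} {zero}  L j≢v = refl
force-other {suc j} {suc v} L j≢v = force-other (L ∘ suc) (j≢v ∘ cong suc)

occurrences-forced-below : ∀ n k → occurrences forced n (below k) ≡ 0
occurrences-forced-below zero    k       = refl
occurrences-forced-below (suc n) zero    = occurrences-forced-below n zero
occurrences-forced-below (suc n) (suc k) = occurrences-forced-below n k

occurrences-free-below : ∀ n k → k ≤ n → occurrences free n (below k) + k ≡ n
occurrences-free-below zero    zero    z≤n     = refl
occurrences-free-below (suc n) zero    z≤n     = cong suc (occurrences-free-below n zero z≤n)
occurrences-free-below (suc n) (suc k) (s≤s p) =
  trans (+-suc (occurrences free n (below k)) k) (cong suc (occurrences-free-below n k p))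

occurrences-forced-force : ∀ {n} (x : Fin n) {j} L → toℕ x ≡ j → L j ≡ free →
  occurrences forced n (force j L) ≡ suc (occurrences forced n L)
occurrences-forced-force {suc n} Fin.zero    L refl free≡ =
  cong (λ l → suc (indicator l forced + occurrences forced n (L ∘ suc))) (sym free≡)
occurrences-forced-force         (Fin.suc x) L refl free≡ =
  trans (cong (indicator (L 0) forced +_) (occurrences-forced-force x (L ∘ suc) refl free≡)) (+-suc _ _)

occurrences-free-force : ∀ {n} (x : Fin n) {j} L → toℕ x ≡ j → L j ≡ free →
  suc (occurrences free n (force j L)) ≡ occurrences free n L
occurrences-free-force {suc n} Fin.zero    L refl free≡ =
  cong (λ l → indicator l free + occurrences free n (L ∘ suc)) (sym free≡)
occurrences-free-force         (Fin.suc x) L refl free≡ =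
  trans (sym (+-suc _ _)) (cong (indicator (L 0) free +_) (occurrences-free-force x (L ∘ suc) refl free≡))

Above : ∀ {n} → ℕ → Subset n → Set
Above k s = ∀ a → a ∈ s → k ≤ toℕ a

MeetsBelow : ∀ {n} → ℕ → Subset n → Set
MeetsBelow k s = ∃ λ a → a ∈ s × toℕ a < k

meetsBelow? : ∀ {n} k → Decidable (MeetsBelow {n} k)
meetsBelow? k s = Finₚ.any? (λ a → a ∈? s ×-dec toℕ a <? k)

above⇒¬meetsBelow : ∀ {n k} {s : Subset n} → Above k s → ¬ MeetsBelow k s
above⇒¬meetsBelow above (a , a∈ , a<k) = <⇒≱ a<k (above a a∈)

¬meetsBelow⇒above : ∀ {n k} {s : Subset n} → ¬ MeetsBelow k s → Above k s
¬meetsBelow⇒above ¬meets a a∈ = ≮⇒≥ (λ a<k → ¬meets (a , a∈ , a<k))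

respects-below : ∀ {n} k (s : Subset n) → Respects (below k) s ⇔ Above k s
respects-below k s = mk⇔ (to k s) (from k s)
  where
  to : ∀ {n} k (s : Subset n) → Respects (below k) s → Above k s
  to zero    s               _        _           _         = z≤n
  to (suc k) (true ∷ s)      (() , _) Fin.zero    here
  to (suc k) (b ∷ s)         (_ , r)  (Fin.suc a) (there m) = s≤s (to k s r a m)
  from : ∀ {n} k (s : Subset n) → Above k s → Respects (below k) s
  from k       []          _     = tt
  from zero    (b ∷ s)     _     = tt , from zero s λ _ _ → z≤n
  from (suc k) (true ∷ s)  above with () ← above Fin.zero here
  from (suc k) (false ∷ s) above = refl , from k s λ a m → ≤-pred (above (Fin.suc a) (there m))

respects-force : ∀ {n} (x : Fin n) {j} L (s : Subset n) → toℕ x ≡ j → L j ≡ free →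
  Respects (force j L) s ⇔ (x ∈ s × Respects L s)
respects-force x L s refl free≡ = mk⇔ (to x L s free≡) (from x L s)
  where
  to : ∀ {n} (x : Fin n) L (s : Subset n) → L (toℕ x) ≡ free → Respects (force (toℕ x) L) s → x ∈ s × Respects L s
  to Fin.zero    L (true ∷ s) free≡ (refl , r) = here , subst (λ l → Fits l true) (sym free≡) tt , r
  to (Fin.suc x) L (b ∷ s)    free≡ (f , r)    with m , r′ ← to x (L ∘ suc) s free≡ r = there m , f , r′
  from : ∀ {n} (x : Fin n) L (s : Subset n) → x ∈ s × Respects L s → Respects (force (toℕ x) L) s
  from Fin.zero    L (true ∷ s) (here , _ , r)    = refl , r
  from (Fin.suc x) L (b ∷ s)    (there m , f , r) = f , from x (L ∘ suc) s (m , r)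

x∈p⇒1≤∣p∣ : ∀ {n} {x : Fin n} {p : Subset n} → x ∈ p → 1 ≤ ∣ p ∣
x∈p⇒1≤∣p∣ x∈p = ≤-trans (s≤s z≤n) (x∈p⇒∣p-x∣<∣p∣ x∈p)

x,y∈p⇒2≤∣p∣ : ∀ {n} {x y : Fin n} {p : Subset n} → x ∈ p → y ∈ p → x ≢ y → 2 ≤ ∣ p ∣
x,y∈p⇒2≤∣p∣ x∈p y∈p x≢y =
  ≤-trans (s≤s (x∈p⇒1≤∣p∣ (x∈p∧x≢y⇒x∈p-y y∈p (x≢y ∘ sym)))) (x∈p⇒∣p-x∣<∣p∣ x∈p)

disjoint-family-¬meetsBelow : ∀ {n} k (f : Fin (suc k) → Subset n) →
  (∀ {i j} → i Fin.< j → ∣ f i ∩ f j ∣ ≡ 0) → ¬ (∀ i → MeetsBelow k (f i))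
disjoint-family-¬meetsBelow {n} k f disjoint meets =
  collision (Finₚ.pigeonhole (n<1+n k) (λ i → fromℕ< (vertex<k i)))
  where
  vertex : Fin (suc k) → Fin n
  vertex = proj₁ ∘ meets
  vertex∈ : ∀ i → vertex i ∈ f i
  vertex∈ = proj₁ ∘ proj₂ ∘ meets
  vertex<k : ∀ i → toℕ (vertex i) < k
  vertex<k = proj₂ ∘ proj₂ ∘ meets
  collision : (∃₂ λ i j → i Fin.< j × fromℕ< (vertex<k i) ≡ fromℕ< (vertex<k j)) → ⊥
  collision (i , j , i<j , same) =
    <⇒≱ (s≤s z≤n) (≤-trans (x∈p⇒1≤∣p∣ (x∈p∩q⁺ (vertex∈ i , subst (_∈ f j) (sym shared) (vertex∈ j))))
                           (≤-reflexive (disjoint i<j)))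
    where
    shared : vertex i ≡ vertex j
    shared = Finₚ.toℕ-injective (Finₚ.fromℕ<-injective _ _ (vertex<k i) (vertex<k j) same)

every-other : ∀ k p {L} → 2 * k + p < L → Fin (suc k) → Fin L
every-other k p h m = fromℕ< (≤-trans (s≤s (+-monoˡ-≤ p (*-monoʳ-≤ 2 (≤-pred (Finₚ.toℕ<n m))))) h)

toℕ-every-other : ∀ k p {L} (h : 2 * k + p < L) m → toℕ (every-other k p h m) ≡ 2 * toℕ m + p
toℕ-every-other k p h m = Finₚ.toℕ-fromℕ< _

every-other-apart : ∀ k p {L} (h : 2 * k + p < L) {i j : Fin (suc k)} → i Fin.< j →
  suc (toℕ (every-other k p h i)) < toℕ (every-other k p h j)
every-other-apart k p h {i} {j} i<j =
  subst₂ (λ a b → suc a < b) (sym (toℕ-every-other k p h i)) (sym (toℕ-every-other k p h j))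
    (≤-trans (≤-reflexive (two-steps (toℕ i) p)) (+-monoˡ-≤ p (*-monoʳ-≤ 2 i<j)))
  where
  two-steps : ∀ a p → suc (suc (2 * a + p)) ≡ 2 * suc a + p
  two-steps = solve-∀

module LinearPath {n L} (e : Fin L → Subset n)
  (adjacent : ∀ i j → suc (toℕ i) ≡ toℕ j → ∣ e i ∩ e j ∣ ≡ 1)
  (apart : ∀ i j → suc (toℕ i) < toℕ j → ∣ e i ∩ e j ∣ ≡ 0) where

  ordered-no-common-pair : ∀ {i j} {x y : Fin n} → toℕ i < toℕ j → x ≢ y →
    x ∈ e i → x ∈ e j → y ∈ e i → y ∈ e j → ⊥
  ordered-no-common-pair {i} {j} i<j x≢y xi xj yi yj with suc (toℕ i) ≟ toℕ j
  ... | yes next = <⇒≱ (s≤s (s≤s z≤n)) (≤-trans two≤ (≤-reflexive (adjacent i j next)))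
    where two≤ = x,y∈p⇒2≤∣p∣ (x∈p∩q⁺ (xi , xj)) (x∈p∩q⁺ (yi , yj)) x≢y
  ... | no ¬next =
    <⇒≱ (s≤s z≤n) (≤-trans (x∈p⇒1≤∣p∣ (x∈p∩q⁺ (xi , xj))) (≤-reflexive (apart i j (≤∧≢⇒< i<j ¬next))))

  no-common-pair : ∀ {i j} {x y : Fin n} → toℕ i ≢ toℕ j → x ≢ y →
    x ∈ e i → x ∈ e j → y ∈ e i → y ∈ e j → ⊥
  no-common-pair {i} {j} i≢j x≢y xi xj yi yj with <-cmp (toℕ i) (toℕ j)
  ... | tri< i<j _ _ = ordered-no-common-pair i<j x≢y xi xj yi yj
  ... | tri≈ _ i≡j _ = i≢j i≡j
  ... | tri> _ _ j<i = ordered-no-common-pair j<i x≢y xj xi yj yi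

  every-other-¬meetsBelow : ∀ k p (h : 2 * k + p < L) → ¬ (∀ m → MeetsBelow k (e (every-other k p h m)))
  every-other-¬meetsBelow k p h =
    disjoint-family-¬meetsBelow k (e ∘ every-other k p h) (λ i<j → apart _ _ (every-other-apart k p h i<j))

S3-no-linear-path : ∀ n k → ¬ HasLinearPath (S3 n k) (2 * k + 1)
S3-no-linear-path n k (e , edge , adjacent , apart) =
  every-other-¬meetsBelow k 0 (+-monoʳ-< (2 * k) (s≤s z≤n)) (λ m → proj₂ (edge _))
  where open LinearPath e adjacent apart

-- s contains the vertices u and w (indices k and k + 1) spanning the added edges of S₃⁺(n,k).
Hub : ∀ {n} → ℕ → Subset n → Set
Hub k s = (∃ λ u → u ∈ s × toℕ u ≡ k) × (∃ λ w → w ∈ s × toℕ w ≡ suc k)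

S3⁺-edge-hub : ∀ {n k} {s : Subset n} → S3PlusEdge n k s → ¬ MeetsBelow k s → Hub k s
S3⁺-edge-hub (inj₁ (_ , meets))  ¬meets = ⊥-elim (¬meets meets)
S3⁺-edge-hub (inj₂ (_ , _ , hub)) _     = hub

S3⁺-no-linear-path : ∀ n k → ¬ HasLinearPath (S3⁺ n k) (2 * k + 2)
S3⁺-no-linear-path n k (e , edge , adjacent , apart) = evens-or-odds (Finₚ.all? (meetsBelow? k ∘ e ∘ even))
  where
  open LinearPath e adjacent apart
  even≺ : 2 * k + 0 < 2 * k + 2
  even≺ = +-monoʳ-< (2 * k) (s≤s z≤n)
  odd≺ : 2 * k + 1 < 2 * k + 2
  odd≺ = +-monoʳ-< (2 * k) (s≤s (s≤s z≤n))
  even odd : Fin (suc k) → Fin (2 * k + 2)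
  even = every-other k 0 even≺
  odd  = every-other k 1 odd≺

  even≢odd-index : ∀ m m′ → toℕ (even m) ≢ toℕ (odd m′)
  even≢odd-index m m′ eq = even≢odd (toℕ m) (toℕ m′) (begin
    2 * toℕ m      ≡⟨ sym (+-identityʳ _) ⟩
    2 * toℕ m + 0  ≡⟨ sym (toℕ-every-other k 0 even≺ m) ⟩
    toℕ (even m)   ≡⟨ eq ⟩
    toℕ (odd m′)   ≡⟨ toℕ-every-other k 1 odd≺ m′ ⟩
    2 * toℕ m′ + 1 ≡⟨ +-comm _ 1 ⟩
    suc (2 * toℕ m′) ∎)
    where open ≡-Reasoning

  two-hubs : ∀ {i j} → toℕ i ≢ toℕ j → Hub k (e i) → Hub k (e j) → ⊥
  two-hubs i≢j ((u , ui , refl) , (w , wi , w≡)) ((u′ , uj , u′≡) , (w′ , wj , w′≡)) =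
    no-common-pair i≢j (λ u≡w → 1+n≢n (sym (trans (cong toℕ u≡w) w≡)))
      ui (subst (_∈ e _) (Finₚ.toℕ-injective u′≡) uj)
      wi (subst (_∈ e _) (Finₚ.toℕ-injective (trans w′≡ (sym w≡))) wj)

  evens-or-odds : Dec (∀ m → MeetsBelow k (e (even m))) → ⊥
  evens-or-odds (yes evens) = every-other-¬meetsBelow k 0 even≺ evens
  evens-or-odds (no ¬evens) = every-other-¬meetsBelow k 1 odd≺ odds
    where
    missed : ∃ λ m → ¬ MeetsBelow k (e (even m))
    missed = Finₚ.¬∀⟶∃¬ _ _ (meetsBelow? k ∘ e ∘ even) ¬evens
    odds : ∀ m → MeetsBelow k (e (odd m))
    odds m with meetsBelow? k (e (odd m))
    ... | yes meets = meets
    ... | no ¬meets = ⊥-elim (two-hubs (even≢odd-index (proj₁ missed) m)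
                                       (S3⁺-edge-hub (edge (even (proj₁ missed))) (proj₂ missed))
                                       (S3⁺-edge-hub (edge (odd m)) ¬meets))

throughAbove : ∀ {n} → ℕ → Fin n → Pattern
throughAbove k v = force (toℕ v) (below k)

respects-throughAbove : ∀ {n k} (v : Fin n) (s : Subset n) → k ≤ toℕ v →
  Respects (throughAbove k v) s ⇔ (v ∈ s × Above k s)
respects-throughAbove {k = k} v s k≤v = mk⇔
  (λ r → let v∈ , r′ = Equivalence.to through r in v∈ , Equivalence.to (respects-below k s) r′)
  (λ (v∈ , above) → Equivalence.from through (v∈ , Equivalence.from (respects-below k s) above))
  where through = respects-force v (below k) s refl (below-free k≤v)

occurrences-forced-throughAbove : ∀ {n} k (v : Fin n) → k ≤ toℕ v → occurrences forced n (throughAbove k v) ≡ 1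
occurrences-forced-throughAbove {n} k v k≤v =
  trans (occurrences-forced-force v (below k) refl (below-free k≤v)) (cong suc (occurrences-forced-below n k))

occurrences-free-throughAbove : ∀ {n} k (v : Fin n) f → k ≤ toℕ v → f + suc k ≡ n →
  occurrences free n (throughAbove k v) ≡ f
occurrences-free-throughAbove {n} k v f k≤v f+1+k≡n = +-cancelʳ-≡ (suc k) _ f (begin
  occurrences free n (throughAbove k v) + suc k      ≡⟨ +-suc _ k ⟩
  suc (occurrences free n (throughAbove k v)) + k    ≡⟨ cong (_+ k) (occurrences-free-force v (below k) refl (below-free k≤v)) ⟩
  occurrences free n (below k) + k                   ≡⟨ occurrences-free-below n k (≤-trans k≤v (<⇒≤ (Finₚ.toℕ<n v))) ⟩
  n                                                  ≡⟨ sym f+1+k≡n ⟩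
  f + suc k                                          ∎)
  where open ≡-Reasoning

countSubsets-throughAbove : ∀ {n} k (v : Fin n) f → k ≤ toℕ v → f + suc k ≡ n →
  countSubsets n (sizedRespecting? (throughAbove k v) 3) ≡ f C 2
countSubsets-throughAbove {n} k v f k≤v f+1+k≡n =
  trans (countSubsets-sizedRespecting n (throughAbove k v) 3)
        (cong₂ (λ f c → supersets f c 3) (occurrences-free-throughAbove k v f k≤v f+1+k≡n)
                                          (occurrences-forced-throughAbove k v k≤v))

module _ {n k : ℕ} (v : Fin n) where

  private
    Triple? : ∀ j → Decidable (SizedRespecting {n} (throughAbove j v) 3)
    Triple? j = sizedRespecting? (throughAbove j v) 3

    through : ∀ {s} → Respects (throughAbove 0 v) s ⇔ v ∈ s
    through {s} = mk⇔ (proj₁ ∘ Equivalence.to (respects-throughAbove v s z≤n))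
                      (λ v∈ → Equivalence.from (respects-throughAbove v s z≤n) (v∈ , λ _ _ → z≤n))

    edges-through : degree (S3 n k) v ≡ countSubsets n (λ s → Triple? 0 s ×-dec S3Edge? n k s)
    edges-through = countSubsets-cong n _ _
      (λ (edge , v∈) → (proj₁ edge , Equivalence.from through v∈) , edge)
      (λ ((_ , r) , edge) → edge , Equivalence.to through r)

    non-edges-through : k ≤ toℕ v →
      countSubsets n (Triple? k) ≡ countSubsets n (λ s → Triple? 0 s ×-dec ¬? (S3Edge? n k s))
    non-edges-through k≤v = countSubsets-cong n _ _
      (λ (size , r) → (size , Equivalence.from through (proj₁ (split r))) ,
                      above⇒¬meetsBelow (proj₂ (split r)) ∘ proj₂)
      (λ ((size , r) , ¬edge) → size , Equivalence.from (respects-throughAbove v _ k≤v)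
         (Equivalence.to through r , ¬meetsBelow⇒above (λ meets → ¬edge (size , meets))))
      where
      split : ∀ {s} → Respects (throughAbove k v) s → v ∈ s × Above k s
      split = Equivalence.to (respects-throughAbove v _ k≤v)

  degree-S3-below : ∀ f → toℕ v < k → f + 1 ≡ n → degree (S3 n k) v ≡ f C 2
  degree-S3-below f v<k f+1≡n = trans
    (countSubsets-cong n _ (Triple? 0)
      (λ ((size , _) , v∈) → size , Equivalence.from through v∈)
      (λ (size , r) → (size , v , Equivalence.to through r , v<k) , Equivalence.to through r))
    (countSubsets-throughAbove 0 v f z≤n f+1≡n)

  degree-S3-above : ∀ f → k ≤ toℕ v → f + suc k ≡ n → degree (S3 n k) v + f C 2 ≡ (f + k) C 2
  degree-S3-above f k≤v f+1+k≡n = begin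
    degree (S3 n k) v + f C 2
      ≡⟨ cong₂ _+_ edges-through (trans (sym (countSubsets-throughAbove k v f k≤v f+1+k≡n)) (non-edges-through k≤v)) ⟩
    countSubsets n (λ s → Triple? 0 s ×-dec S3Edge? n k s) +
    countSubsets n (λ s → Triple? 0 s ×-dec ¬? (S3Edge? n k s))
      ≡⟨ sym (length-filter-split (Triple? 0) (S3Edge? n k) (allSubsets n)) ⟩
    countSubsets n (Triple? 0)
      ≡⟨ countSubsets-throughAbove 0 v (f + k) z≤n (trans (+-comm (f + k) 1) (trans (sym (+-suc f k)) f+1+k≡n)) ⟩
    (f + k) C 2 ∎
    where open ≡-Reasoning

extraDegree : ∀ n k → Fin n → ℕ
extraDegree n k v = countSubsets n (λ s → (S3PlusEdge? n k s ×-dec v ∈? s) ×-dec ¬? (S3Edge? n k s))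

degree-S3⁺ : ∀ {n k} (v : Fin n) → degree (S3⁺ n k) v ≡ degree (S3 n k) v + extraDegree n k v
degree-S3⁺ {n} {k} v =
  trans (length-filter-split (λ s → S3PlusEdge? n k s ×-dec v ∈? s) (S3Edge? n k) (allSubsets n))
        (cong (_+ extraDegree n k v) (countSubsets-cong n _ _
          (λ ((_ , v∈) , edge) → edge , v∈) (λ (edge , v∈) → (inj₁ edge , v∈) , edge)))

extraDegree-hub : ∀ {n k} (x v : Fin n) → toℕ v ≡ k ⊎ toℕ v ≡ suc k → extraDegree n k x ≤ extraDegree n k v
extraDegree-hub {n} {k} x v hub-vertex = length-filter-mono _ _ extra (allSubsets n)
  where
  member : ∀ {s} → toℕ v ≡ k ⊎ toℕ v ≡ suc k → Hub k s → v ∈ s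
  member (inj₁ v≡) ((u , u∈ , u≡) , _) = subst (_∈ _) (Finₚ.toℕ-injective (trans u≡ (sym v≡))) u∈
  member (inj₂ v≡) (_ , (w , w∈ , w≡)) = subst (_∈ _) (Finₚ.toℕ-injective (trans w≡ (sym v≡))) w∈
  extra : ∀ {s} → (S3PlusEdge n k s × x ∈ s) × ¬ S3Edge n k s → (S3PlusEdge n k s × v ∈ s) × ¬ S3Edge n k s
  extra ((inj₁ edge , _) , ¬edge) = ⊥-elim (¬edge edge)
  extra ((inj₂ edge , _) , ¬edge) = (inj₂ edge , member hub-vertex (proj₂ (proj₂ edge))) , ¬edge

module _ {n k : ℕ} (v : Fin n) (k+2≤v : suc (suc k) ≤ toℕ v) where

  hubThrough : Pattern
  hubThrough = force k (force (suc k) (throughAbove k v))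

  private
    k≤v : k ≤ toℕ v
    k≤v = ≤-trans (n≤1+n k) (≤-trans (n≤1+n (suc k)) k+2≤v)
    1+k<n : suc k < n
    1+k<n = <-≤-trans k+2≤v (<⇒≤ (Finₚ.toℕ<n v))
    u w : Fin n
    u = fromℕ< (<-trans (n<1+n k) 1+k<n)
    w = fromℕ< 1+k<n
    w-free : throughAbove k v (suc k) ≡ free
    w-free = trans (force-other (below k) (<⇒≢ k+2≤v)) (below-free (n≤1+n k))
    u-free : force (suc k) (throughAbove k v) k ≡ free
    u-free = trans (force-other (throughAbove k v) (<⇒≢ (n<1+n k)))
            (trans (force-other (below k) (<⇒≢ (≤-trans (n≤1+n (suc k)) k+2≤v))) (below-free (≤-refl {k})))

  occurrences-forced-hubThrough : occurrences forced n hubThrough ≡ 3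
  occurrences-forced-hubThrough =
    trans (occurrences-forced-force u _ (Finₚ.toℕ-fromℕ< _) u-free)
          (cong suc (trans (occurrences-forced-force w _ (Finₚ.toℕ-fromℕ< _) w-free)
                           (cong suc (occurrences-forced-throughAbove k v k≤v))))

  respects-hubThrough : ∀ s → Respects hubThrough s ⇔ (Hub k s × v ∈ s × Above k s)
  respects-hubThrough s = mk⇔ to from
    where
    to : Respects hubThrough s → Hub k s × v ∈ s × Above k s
    to r with u∈ , r₁     ← Equivalence.to (respects-force u _ s (Finₚ.toℕ-fromℕ< _) u-free) r
         with w∈ , r₂     ← Equivalence.to (respects-force w _ s (Finₚ.toℕ-fromℕ< _) w-free) r₁
         with v∈ , above  ← Equivalence.to (respects-throughAbove v s k≤v) r₂
         = ((u , u∈ , Finₚ.toℕ-fromℕ< _) , (w , w∈ , Finₚ.toℕ-fromℕ< _)) , v∈ , above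
    from : Hub k s × v ∈ s × Above k s → Respects hubThrough s
    from (((u′ , u′∈ , u′≡) , (w′ , w′∈ , w′≡)) , v∈ , above) =
      Equivalence.from (respects-force u′ _ s u′≡ u-free) (u′∈ ,
      Equivalence.from (respects-force w′ _ s w′≡ w-free) (w′∈ ,
      Equivalence.from (respects-throughAbove v s k≤v) (v∈ , above)))

  extraDegree-far : extraDegree n k v ≡ 1
  extraDegree-far =
    trans (countSubsets-cong n _ (sizedRespecting? hubThrough 3) to from)
          (trans (countSubsets-sizedRespecting n hubThrough 3)
                 (cong (λ c → supersets (occurrences free n hubThrough) c 3) occurrences-forced-hubThrough))
    where
    to : ∀ {s} → (S3PlusEdge n k s × v ∈ s) × ¬ S3Edge n k s → SizedRespecting hubThrough 3 s
    to ((inj₁ edge , _) , ¬edge) = ⊥-elim (¬edge edge)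
    to {s} ((inj₂ (size , above , hub) , v∈) , _) =
      size , Equivalence.from (respects-hubThrough s) (hub , v∈ , above)
    from : ∀ {s} → SizedRespecting hubThrough 3 s → (S3PlusEdge n k s × v ∈ s) × ¬ S3Edge n k s
    from {s} (size , r) with hub , v∈ , above ← Equivalence.to (respects-hubThrough s) r =
      (inj₂ (size , above , hub) , v∈) , above⇒¬meetsBelow above ∘ proj₂

2*[nC2]+n≡n*n : ∀ n → 2 * (n C 2) + n ≡ n * n
2*[nC2]+n≡n*n zero    = refl
2*[nC2]+n≡n*n (suc n) = begin
  2 * (suc n C 2) + suc n          ≡⟨ cong (λ c → 2 * c + suc n) (sym (nCk+nC[k+1]≡[n+1]C[k+1] n 1)) ⟩
  2 * (n C 1 + n C 2) + suc n      ≡⟨ cong (λ c → 2 * (c + n C 2) + suc n) (nC1≡n n) ⟩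
  2 * (n + n C 2) + suc n          ≡⟨ regroup n (n C 2) ⟩
  (2 * (n C 2) + n) + suc (n + n)  ≡⟨ cong (_+ suc (n + n)) (2*[nC2]+n≡n*n n) ⟩
  n * n + suc (n + n)              ≡⟨ square n ⟩
  suc n * suc n                    ∎
  where
  open ≡-Reasoning
  regroup : ∀ n c → 2 * (n + c) + suc n ≡ (2 * c + n) + suc (n + n)
  regroup = solve-∀
  square : ∀ n → n * n + suc (n + n) ≡ suc n * suc n
  square = solve-∀

1≤[2+n]C2 : ∀ n → 1 ≤ (2 + n) C 2
1≤[2+n]C2 n = begin
  1                          ≤⟨ s≤s z≤n ⟩
  suc n                      ≡⟨ sym (nC1≡n (suc n)) ⟩
  suc n C 1                  ≤⟨ m≤m+n _ _ ⟩
  suc n C 1 + suc n C 2      ≡⟨ nCk+nC[k+1]≡[n+1]C[k+1] (suc n) 1 ⟩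
  (2 + n) C 2                ∎
  where open ≤-Reasoning

minDegree-formula : ∀ k m d → d + (2 + m) C 2 ≡ (2 + m + k) C 2 → 2 * d + k * k + 3 * k ≡ 2 * (k * (k + 3 + m))
minDegree-formula k m d d+E≡D = +-cancelʳ-≡ (2 * E + (2 + m)) _ _ (begin
  2 * d + k * k + 3 * k + (2 * E + (2 + m))     ≡⟨ regroup k m d E ⟩
  2 * (d + E) + (2 + m + k) + k * k + 2 * k     ≡⟨ cong (λ x → 2 * x + (2 + m + k) + k * k + 2 * k) d+E≡D ⟩
  2 * D + (2 + m + k) + k * k + 2 * k           ≡⟨ cong (λ x → x + k * k + 2 * k) (2*[nC2]+n≡n*n (2 + m + k)) ⟩
  (2 + m + k) * (2 + m + k) + k * k + 2 * k     ≡⟨ expand k m ⟩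
  2 * (k * (k + 3 + m)) + (2 + m) * (2 + m)     ≡⟨ cong (2 * (k * (k + 3 + m)) +_) (sym (2*[nC2]+n≡n*n (2 + m))) ⟩
  2 * (k * (k + 3 + m)) + (2 * E + (2 + m))     ∎)
  where
  open ≡-Reasoning
  E D : ℕ
  E = (2 + m) C 2
  D = (2 + m + k) C 2
  regroup : ∀ k m d E → 2 * d + k * k + 3 * k + (2 * E + (2 + m)) ≡ 2 * (d + E) + (2 + m + k) + k * k + 2 * k
  regroup = solve-∀
  expand : ∀ k m → (2 + m + k) * (2 + m + k) + k * k + 2 * k ≡ 2 * (k * (k + 3 + m)) + (2 + m) * (2 + m)
  expand = solve-∀

module MinDegree (k m : ℕ) where

  n : ℕ
  n = k + 3 + m

  -- The last vertex lies in B \ {u, w}; it attains the minimum degree of both graphs.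
  last : Fin n
  last = fromℕ< (≤-reflexive (size k m))
    where
    size : ∀ k m → suc (2 + m + k) ≡ k + 3 + m
    size = solve-∀

  toℕ-last : toℕ last ≡ 2 + m + k
  toℕ-last = Finₚ.toℕ-fromℕ< _

  k+2≤last : suc (suc k) ≤ toℕ last
  k+2≤last = subst (suc (suc k) ≤_) (sym toℕ-last) (s≤s (s≤s (m≤n+m k m)))

  k≤last : k ≤ toℕ last
  k≤last = ≤-trans (n≤1+n k) (≤-trans (n≤1+n (suc k)) k+2≤last)

  δ : ℕ
  δ = degree (S3 n k) last

  degree-above : ∀ v → k ≤ toℕ v → degree (S3 n k) v + (2 + m) C 2 ≡ (2 + m + k) C 2
  degree-above v k≤v = degree-S3-above v (2 + m) k≤v (split k m)
    where
    split : ∀ k m → 2 + m + suc k ≡ k + 3 + m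
    split = solve-∀

  δ-formula : δ + (2 + m) C 2 ≡ (2 + m + k) C 2
  δ-formula = degree-above last k≤last

  degree-above≡δ : ∀ v → k ≤ toℕ v → degree (S3 n k) v ≡ δ
  degree-above≡δ v k≤v = +-cancelʳ-≡ ((2 + m) C 2) _ _ (trans (degree-above v k≤v) (sym δ-formula))

  δ<degree-below : ∀ v → toℕ v < k → δ < degree (S3 n k) v
  δ<degree-below v v<k = begin-strict
    δ                        <⟨ m<m+n δ (1≤[2+n]C2 m) ⟩
    δ + (2 + m) C 2          ≡⟨ δ-formula ⟩
    (2 + m + k) C 2          ≡⟨ degree-S3-below v (2 + m + k) v<k (whole k m) ⟨
    degree (S3 n k) v        ∎
    where
    open ≤-Reasoning
    whole : ∀ k m → 2 + m + k + 1 ≡ k + 3 + m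
    whole = solve-∀

  S3-minDegree : MinDegreeIs (S3 n k) δ
  S3-minDegree = lower , last , refl
    where
    lower : ∀ v → δ ≤ degree (S3 n k) v
    lower v with toℕ v <? k
    ... | yes v<k = <⇒≤ (δ<degree-below v v<k)
    ... | no  v≮k = ≤-reflexive (sym (degree-above≡δ v (≮⇒≥ v≮k)))

  1≤extraDegree-hub : ∀ v → toℕ v ≡ k ⊎ toℕ v ≡ suc k → 1 ≤ extraDegree n k v
  1≤extraDegree-hub v hub = ≤-trans (≤-reflexive (sym (extraDegree-far last k+2≤last))) (extraDegree-hub last v hub)

  1≤extraDegree : ∀ v → k ≤ toℕ v → 1 ≤ extraDegree n k v
  1≤extraDegree v k≤v with toℕ v ≟ k | toℕ v ≟ suc k
  ... | yes v≡k | _         = 1≤extraDegree-hub v (inj₁ v≡k)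
  ... | no _    | yes v≡1+k = 1≤extraDegree-hub v (inj₂ v≡1+k)
  ... | no v≢k  | no v≢1+k  =
    ≤-reflexive (sym (extraDegree-far v (≤∧≢⇒< (≤∧≢⇒< k≤v (v≢k ∘ sym)) (v≢1+k ∘ sym))))

  S3⁺-minDegree : MinDegreeIs (S3⁺ n k) (suc δ)
  S3⁺-minDegree =
    lower , last , trans (degree-S3⁺ last) (trans (cong (δ +_) (extraDegree-far last k+2≤last)) (+-comm δ 1))
    where
    lower : ∀ v → suc δ ≤ degree (S3⁺ n k) v
    lower v with toℕ v <? k
    ... | yes v<k = ≤-trans (δ<degree-below v v<k) (≤-trans (m≤m+n _ _) (≤-reflexive (sym (degree-S3⁺ v))))
    ... | no  v≮k = begin
      suc δ                                       ≡⟨ +-comm 1 δ ⟩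
      δ + 1                                       ≤⟨ +-monoʳ-≤ δ (1≤extraDegree v (≮⇒≥ v≮k)) ⟩
      δ + extraDegree n k v                       ≡⟨ cong (_+ extraDegree n k v) (degree-above≡δ v (≮⇒≥ v≮k)) ⟨
      degree (S3 n k) v + extraDegree n k v       ≡⟨ degree-S3⁺ v ⟨
      degree (S3⁺ n k) v                          ∎
      where open ≤-Reasoning

proposition1p3 : (k n : ℕ) → 1 ≤ k → k + 3 ≤ n →
    ((¬ HasLinearPath (S3 n k) (2 * k + 1)) ×
      (∃ λ d → MinDegreeIs (S3 n k) d × (2 * d + k * k + 3 * k ≡ 2 * (k * n)))) ×
    ((¬ HasLinearPath (S3⁺ n k) (2 * k + 2)) ×
      (∃ λ d → MinDegreeIs (S3⁺ n k) d × (2 * d + k * k + 3 * k ≡ 2 * (k * n) + 2)))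
proposition1p3 k n _ k+3≤n with m , refl ← m≤n⇒∃[o]m+o≡n k+3≤n =
  (S3-no-linear-path n k , δ , S3-minDegree , formula) ,
  (S3⁺-no-linear-path n k , suc δ , S3⁺-minDegree , trans (plus-two δ k) (cong (_+ 2) formula))
  where
  open MinDegree k m using (δ; δ-formula; S3-minDegree; S3⁺-minDegree)
  formula : 2 * δ + k * k + 3 * k ≡ 2 * (k * n)
  formula = minDegree-formula k m δ δ-formula
  plus-two : ∀ d k → 2 * suc d + k * k + 3 * k ≡ 2 * d + k * k + 3 * k + 2
  plus-two = solve-∀
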